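{- The minimal weight $d$ of a self-dual linear Kleinian code $C$ of length $n$ satisfies $d\le\lfloor n/2\rfloor+1$.
   Context: Let $K=\{0,a,b,c\}$ be the Kleinian four-group. A linear code of length $n$ is a subgroup $C\subseteq K^n$; $\mathrm{wt}(\mathbf{x})$ is the number of nonzero coordinates, and the minimal weight is $d=\min\{\mathrm{wt}(\mathbf{x}):\mathbf{x}\in C,\mathbf{x}\neq0\}$. Define $x\cdot y\in\mathbb{F}_2$ for $x,y\in K$ by $x\cdot y=1$ iff $x,y$ are nonzero and distinct; $(\mathbf{x},\mathbf{y})=\sum_ix_i\cdot y_i$; $C^\perp=\{\mathbf{x}:(\mathbf{x},\mathbf{y})=0\ \forall \mathbf{y}\in C\}$; $C$ is self-dual if $C=C^\perp$. -}

module Defs where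

open import Data.Nat using (ℕ; zero; suc; _+_; _≤_)
open import Data.Vec using (Vec; []; _∷_; replicate; zipWith)
open import Data.Product using (_×_; Σ)
open import Relation.Binary.PropositionalEquality using (_≡_)
open import Relation.Nullary using (¬_)
open import Data.Bool using (Bool; true; false; _xor_)

data K : Set where
  O a b c : K

_⊕_ : K → K → K
O ⊕ y = y
x ⊕ O = x
a ⊕ a = O
a ⊕ b = c
a ⊕ c = b
b ⊕ a = c
b ⊕ b = O
b ⊕ c = a
c ⊕ a = b
c ⊕ b = a
c ⊕ c = O

_·_ : K → K → Bool
O · _ = false
_ · O = false
a · a = false
b · b = false
c · c = false
a · _ = true
b · _ = true
c · _ = true

Word : ℕ → Set
Word n = Vec K n

zeroWord : ∀ {n} → Word n
zeroWord = replicate _ O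

_⊕ᵥ_ : ∀ {n} → Word n → Word n → Word n
_⊕ᵥ_ = zipWith _⊕_

inner : ∀ {n} → Word n → Word n → Bool
inner [] [] = false
inner (x ∷ xs) (y ∷ ys) = (x · y) xor inner xs ys

wt : ∀ {n} → Word n → ℕ
wt [] = 0
wt (O ∷ xs) = wt xs
wt (a ∷ xs) = suc (wt xs)
wt (b ∷ xs) = suc (wt xs)
wt (c ∷ xs) = suc (wt xs)

Code : ℕ → Set₁
Code n = Word n → Set

-- linear code: a subgroup of Kⁿ (contains 0, closed under the group
-- operation; inverses are automatic since every element is its own inverse)
IsLinear : ∀ {n} → Code n → Set
IsLinear {n} C = C zeroWord × (∀ (x y : Word n) → C x → C y → C (x ⊕ᵥ y))

Dual : ∀ {n} → Code n → Code n
Dual {n} C x = ∀ (y : Word n) → C y → inner x y ≡ false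

IsSelfDual : ∀ {n} → Code n → Set
IsSelfDual {n} C = ∀ (x : Word n) → (C x → Dual C x) × (Dual C x → C x)

IsMinimalWeight : ∀ {n} → Code n → ℕ → Set
IsMinimalWeight {n} C d =
  Σ (Word n) (λ x → C x × ¬ (x ≡ zeroWord) × wt x ≡ d)
  × (∀ (x : Word n) → C x → ¬ (x ≡ zeroWord) → d ≤ wt x)

-- Split the coordinates as s + m with s = ⌊n/2⌋ + 1 and m < s.  If no nonzero
-- codeword of C were supported on the first s coordinates, then projecting to the
-- last m coordinates would embed C into K^m ≅ F₂^{2m}, so C would be spanned by
-- at most 2m words g₁, …, g_l.  The map u ↦ ((u,0) · gᵢ)ᵢ from K^s to F₂^l is then
-- injective: equal images put the difference (u + u′, 0) into C^⊥ = C.  This is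
-- impossible, as 4^s > 2^{2m} ≥ 2^l.  Hence some nonzero codeword has weight ≤ s.
module Submission where

open import Defs
open import Algebra.Bundles using (CommutativeRing)
open import Data.Bool using (Bool; true; false; _xor_; _∧_)
open import Data.Bool.Properties
  using (xor-assoc; xor-comm; xor-same; ∧-comm; ∧-distribˡ-xor; xor-∧-commutativeRing)
open import Algebra.Properties.CommutativeSemigroup
  (CommutativeRing.+-commutativeSemigroup xor-∧-commutativeRing) using (interchange)
open import Data.Empty using (⊥-elim)
open import Data.Fin as Fin using (Fin; combine; remQuot)
open import Data.Fin.Properties using (2↔Bool; remQuot-combine; combine-remQuot; injective⇒≤)
open import Data.List using (List; []; _∷_; length)
open import Data.Nat
  using (ℕ; zero; suc; _+_; _*_; _^_; _/_; _%_; _≤_; _<_; z≤n; s≤s; _≤?_; NonZero; ≢-nonZero⁻¹)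
open import Data.Nat.DivMod using (m≡m%n+[m/n]*n; m%n<n)
open import Data.Nat.Properties
  using (≤-refl; <⇒≱; ≰⇒>; m≤n⇒m≤1+n; m≤m+n; m<m+n; +-identityʳ; *-comm; *-monoˡ-<;
         ^-monoʳ-≤; ^-monoʳ-<; ^-*-assoc; module ≤-Reasoning)
open import Data.Nat.Tactic.RingSolver using (solve-∀)
open import Data.Product using (_×_; _,_; proj₁; proj₂; ∃-syntax)
open import Data.Vec using (Vec; []; _∷_; _++_; zipWith; replicate; take; drop; head; tail)
open import Data.Vec.Properties
  using (zipWith-assoc; zipWith-identityˡ; zipWith-identityʳ; zipWith-++; drop-zipWith;
         take++drop≡id; ++-injectiveˡ; ++-injectiveʳ; ∷-injective; ∷-injectiveʳ)
open import Effect.Monad using (RawMonad)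
open import Function using (_↔_; _↣_; _∘_; Inverse; Injection; mk↔ₛ′; mk↣)
open import Function.Properties.Injection using (↣-trans)
open import Function.Properties.Inverse using (↔-sym; ↔-trans; ↔⇒↣)
open import Relation.Binary.PropositionalEquality
open import Relation.Nullary using (¬_; Dec; yes; no; contradiction)
open import Relation.Nullary.Decidable using (map′; ¬¬-excluded-middle)
open import Relation.Nullary.Negation using (¬¬-Monad)
open import Relation.Unary using (_⊆_)

private
  variable
    n m s l N : ℕ

_⊻_ : Vec Bool n → Vec Bool n → Vec Bool n
_⊻_ = zipWith _xor_

-- Transporting along K ≅ F₂² reduces the laws of ⊕ and the bilinearity of · to
-- those of xor and ∧; under it · is the standard symplectic form.
toF₂² : K → Vec Bool 2
toF₂² O = false ∷ false ∷ []
toF₂² a = true ∷ false ∷ []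
toF₂² b = false ∷ true ∷ []
toF₂² c = true ∷ true ∷ []

fromF₂² : Vec Bool 2 → K
fromF₂² (false ∷ false ∷ []) = O
fromF₂² (true ∷ false ∷ []) = a
fromF₂² (false ∷ true ∷ []) = b
fromF₂² (true ∷ true ∷ []) = c

fromF₂²∘toF₂² : ∀ x → fromF₂² (toF₂² x) ≡ x
fromF₂²∘toF₂² O = refl
fromF₂²∘toF₂² a = refl
fromF₂²∘toF₂² b = refl
fromF₂²∘toF₂² c = refl

toF₂²∘fromF₂² : ∀ v → toF₂² (fromF₂² v) ≡ v
toF₂²∘fromF₂² (false ∷ false ∷ []) = refl
toF₂²∘fromF₂² (true ∷ false ∷ []) = refl
toF₂²∘fromF₂² (false ∷ true ∷ []) = refl
toF₂²∘fromF₂² (true ∷ true ∷ []) = refl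

K↔F₂² : K ↔ Vec Bool 2
K↔F₂² = mk↔ₛ′ toF₂² fromF₂² toF₂²∘fromF₂² fromF₂²∘toF₂²

toF₂²-injective : ∀ {x y} → toF₂² x ≡ toF₂² y → x ≡ y
toF₂²-injective {x} {y} eq =
  trans (sym (fromF₂²∘toF₂² x)) (trans (cong fromF₂² eq) (fromF₂²∘toF₂² y))

toF₂²-⊕ : ∀ x y → toF₂² (x ⊕ y) ≡ toF₂² x ⊻ toF₂² y
toF₂²-⊕ O y = sym (zipWith-identityˡ (λ _ → refl) (toF₂² y))
toF₂²-⊕ a O = refl
toF₂²-⊕ a a = refl
toF₂²-⊕ a b = refl
toF₂²-⊕ a c = refl
toF₂²-⊕ b O = refl
toF₂²-⊕ b a = refl
toF₂²-⊕ b b = refl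
toF₂²-⊕ b c = refl
toF₂²-⊕ c O = refl
toF₂²-⊕ c a = refl
toF₂²-⊕ c b = refl
toF₂²-⊕ c c = refl

symplectic : Vec Bool 2 → Vec Bool 2 → Bool
symplectic (p ∷ q ∷ []) (p′ ∷ q′ ∷ []) = (p ∧ q′) xor (q ∧ p′)

·≡symplectic : ∀ x y → x · y ≡ symplectic (toF₂² x) (toF₂² y)
·≡symplectic O O = refl
·≡symplectic O a = refl
·≡symplectic O b = refl
·≡symplectic O c = refl
·≡symplectic a O = refl
·≡symplectic a a = refl
·≡symplectic a b = refl
·≡symplectic a c = refl
·≡symplectic b O = refl
·≡symplectic b a = refl
·≡symplectic b b = refl
·≡symplectic b c = refl
·≡symplectic c O = refl
·≡symplectic c a = refl
·≡symplectic c b = refl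
·≡symplectic c c = refl

symplectic-comm : ∀ u v → symplectic u v ≡ symplectic v u
symplectic-comm (p ∷ q ∷ []) (p′ ∷ q′ ∷ []) =
  trans (xor-comm (p ∧ q′) (q ∧ p′)) (cong₂ _xor_ (∧-comm q p′) (∧-comm p q′))

symplectic-distribˡ-⊻ : ∀ u v w → symplectic u (v ⊻ w) ≡ symplectic u v xor symplectic u w
symplectic-distribˡ-⊻ (p ∷ q ∷ []) (p′ ∷ q′ ∷ []) (p″ ∷ q″ ∷ []) =
  trans (cong₂ _xor_ (∧-distribˡ-xor p q′ q″) (∧-distribˡ-xor q p′ p″))
        (interchange (p ∧ q′) (p ∧ q″) (q ∧ p′) (q ∧ p″))

⊕-assoc : ∀ x y z → (x ⊕ y) ⊕ z ≡ x ⊕ (y ⊕ z)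
⊕-assoc x y z = toF₂²-injective (begin
  toF₂² ((x ⊕ y) ⊕ z)               ≡⟨ toF₂²-⊕ (x ⊕ y) z ⟩
  toF₂² (x ⊕ y) ⊻ toF₂² z           ≡⟨ cong (_⊻ toF₂² z) (toF₂²-⊕ x y) ⟩
  (toF₂² x ⊻ toF₂² y) ⊻ toF₂² z     ≡⟨ zipWith-assoc xor-assoc (toF₂² x) (toF₂² y) (toF₂² z) ⟩
  toF₂² x ⊻ (toF₂² y ⊻ toF₂² z)     ≡⟨ cong (toF₂² x ⊻_) (toF₂²-⊕ y z) ⟨
  toF₂² x ⊻ toF₂² (y ⊕ z)           ≡⟨ toF₂²-⊕ x (y ⊕ z) ⟨
  toF₂² (x ⊕ (y ⊕ z))               ∎)
  where open ≡-Reasoning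

⊕-self : ∀ x → x ⊕ x ≡ O
⊕-self O = refl
⊕-self a = refl
⊕-self b = refl
⊕-self c = refl

⊕-identityʳ : ∀ x → x ⊕ O ≡ x
⊕-identityʳ O = refl
⊕-identityʳ a = refl
⊕-identityʳ b = refl
⊕-identityʳ c = refl

·-comm : ∀ x y → x · y ≡ y · x
·-comm x y = trans (·≡symplectic x y)
  (trans (symplectic-comm (toF₂² x) (toF₂² y)) (sym (·≡symplectic y x)))

·-distribˡ-⊕ : ∀ x y z → x · (y ⊕ z) ≡ (x · y) xor (x · z)
·-distribˡ-⊕ x y z = begin
  x · (y ⊕ z)                                     ≡⟨ ·≡symplectic x (y ⊕ z) ⟩
  symplectic (toF₂² x) (toF₂² (y ⊕ z))            ≡⟨ cong (symplectic (toF₂² x)) (toF₂²-⊕ y z) ⟩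
  symplectic (toF₂² x) (toF₂² y ⊻ toF₂² z)        ≡⟨ symplectic-distribˡ-⊻ (toF₂² x) (toF₂² y) (toF₂² z) ⟩
  symplectic (toF₂² x) (toF₂² y) xor symplectic (toF₂² x) (toF₂² z)
                                                  ≡⟨ cong₂ _xor_ (·≡symplectic x y) (·≡symplectic x z) ⟨
  (x · y) xor (x · z)                             ∎
  where open ≡-Reasoning

·-zeroʳ : ∀ x → x · O ≡ false
·-zeroʳ O = refl
·-zeroʳ a = refl
·-zeroʳ b = refl
·-zeroʳ c = refl

⊕ᵥ-assoc : (x y z : Word n) → (x ⊕ᵥ y) ⊕ᵥ z ≡ x ⊕ᵥ (y ⊕ᵥ z)
⊕ᵥ-assoc = zipWith-assoc ⊕-assoc

⊕ᵥ-identityˡ : (x : Word n) → zeroWord ⊕ᵥ x ≡ x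
⊕ᵥ-identityˡ = zipWith-identityˡ (λ _ → refl)

⊕ᵥ-identityʳ : (x : Word n) → x ⊕ᵥ zeroWord ≡ x
⊕ᵥ-identityʳ = zipWith-identityʳ ⊕-identityʳ

⊕ᵥ-self : (x : Word n) → x ⊕ᵥ x ≡ zeroWord
⊕ᵥ-self [] = refl
⊕ᵥ-self (x ∷ xs) = cong₂ _∷_ (⊕-self x) (⊕ᵥ-self xs)

⊕ᵥ-cancelʳ : (x y : Word n) → (x ⊕ᵥ y) ⊕ᵥ y ≡ x
⊕ᵥ-cancelʳ x y = begin
  (x ⊕ᵥ y) ⊕ᵥ y   ≡⟨ ⊕ᵥ-assoc x y y ⟩
  x ⊕ᵥ (y ⊕ᵥ y)   ≡⟨ cong (x ⊕ᵥ_) (⊕ᵥ-self y) ⟩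
  x ⊕ᵥ zeroWord   ≡⟨ ⊕ᵥ-identityʳ x ⟩
  x               ∎
  where open ≡-Reasoning

⊕ᵥ≡zeroWord⇒≡ : (x y : Word n) → x ⊕ᵥ y ≡ zeroWord → x ≡ y
⊕ᵥ≡zeroWord⇒≡ x y eq = begin
  x               ≡⟨ ⊕ᵥ-cancelʳ x y ⟨
  (x ⊕ᵥ y) ⊕ᵥ y   ≡⟨ cong (_⊕ᵥ y) eq ⟩
  zeroWord ⊕ᵥ y   ≡⟨ ⊕ᵥ-identityˡ y ⟩
  y               ∎
  where open ≡-Reasoning

zeroWord-++ : ∀ s {m} → zeroWord {s} ++ zeroWord {m} ≡ zeroWord
zeroWord-++ zero = refl
zeroWord-++ (suc s) = cong (O ∷_) (zeroWord-++ s)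

zeroWord? : (x : Word n) → Dec (x ≡ zeroWord)
zeroWord? [] = yes refl
zeroWord? (O ∷ x) = map′ (cong (O ∷_)) ∷-injectiveʳ (zeroWord? x)
zeroWord? (a ∷ x) = no λ ()
zeroWord? (b ∷ x) = no λ ()
zeroWord? (c ∷ x) = no λ ()

wt-++ : (u : Word s) (v : Word m) → wt (u ++ v) ≡ wt u + wt v
wt-++ [] v = refl
wt-++ (O ∷ u) v = wt-++ u v
wt-++ (a ∷ u) v = cong suc (wt-++ u v)
wt-++ (b ∷ u) v = cong suc (wt-++ u v)
wt-++ (c ∷ u) v = cong suc (wt-++ u v)

wt-zeroWord : wt (zeroWord {n}) ≡ 0
wt-zeroWord {zero} = refl
wt-zeroWord {suc n} = wt-zeroWord {n}

wt≤length : (u : Word n) → wt u ≤ n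
wt≤length [] = z≤n
wt≤length (O ∷ u) = m≤n⇒m≤1+n (wt≤length u)
wt≤length (a ∷ u) = s≤s (wt≤length u)
wt≤length (b ∷ u) = s≤s (wt≤length u)
wt≤length (c ∷ u) = s≤s (wt≤length u)

inner-comm : (x y : Word n) → inner x y ≡ inner y x
inner-comm [] [] = refl
inner-comm (x ∷ xs) (y ∷ ys) = cong₂ _xor_ (·-comm x y) (inner-comm xs ys)

inner-zeroʳ : (x : Word n) → inner x zeroWord ≡ false
inner-zeroʳ [] = refl
inner-zeroʳ (x ∷ xs) = cong₂ _xor_ (·-zeroʳ x) (inner-zeroʳ xs)

inner-distribˡ-⊕ᵥ : (x y z : Word n) → inner x (y ⊕ᵥ z) ≡ inner x y xor inner x z
inner-distribˡ-⊕ᵥ [] [] [] = refl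
inner-distribˡ-⊕ᵥ (x ∷ xs) (y ∷ ys) (z ∷ zs) =
  trans (cong₂ _xor_ (·-distribˡ-⊕ x y z) (inner-distribˡ-⊕ᵥ xs ys zs))
        (interchange (x · y) (x · z) (inner xs ys) (inner xs zs))

inner-distribʳ-⊕ᵥ : (x y z : Word n) → inner (y ⊕ᵥ z) x ≡ inner y x xor inner z x
inner-distribʳ-⊕ᵥ x y z = begin
  inner (y ⊕ᵥ z) x          ≡⟨ inner-comm (y ⊕ᵥ z) x ⟩
  inner x (y ⊕ᵥ z)          ≡⟨ inner-distribˡ-⊕ᵥ x y z ⟩
  inner x y xor inner x z   ≡⟨ cong₂ _xor_ (inner-comm x y) (inner-comm x z) ⟩
  inner y x xor inner z x   ∎
  where open ≡-Reasoning

bits : Word n → Vec Bool (n * 2)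
bits [] = []
bits (x ∷ xs) = toF₂² x ++ bits xs

bits-⊕ᵥ : (x y : Word n) → bits (x ⊕ᵥ y) ≡ bits x ⊻ bits y
bits-⊕ᵥ [] [] = refl
bits-⊕ᵥ (x ∷ xs) (y ∷ ys) =
  trans (cong₂ _++_ (toF₂²-⊕ x y) (bits-⊕ᵥ xs ys))
        (sym (zipWith-++ _xor_ (toF₂² x) (bits xs) (toF₂² y) (bits ys)))

bits≡0⇒zeroWord : (x : Word n) → bits x ≡ replicate _ false → x ≡ zeroWord
bits≡0⇒zeroWord [] _ = refl
bits≡0⇒zeroWord (x ∷ xs) eq = cong₂ _∷_
  (toF₂²-injective (++-injectiveˡ (toF₂² x) (toF₂² O) eq))
  (bits≡0⇒zeroWord xs (++-injectiveʳ (toF₂² x) (toF₂² O) eq))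

data Span {n} : List (Word n) → Word n → Set where
  none : Span [] zeroWord
  skip : ∀ {g L x} → Span L x → Span (g ∷ L) x
  add  : ∀ {g L x} → Span L x → Span (g ∷ L) (x ⊕ᵥ g)

head-⊻ : (u v : Vec Bool (suc N)) → head (u ⊻ v) ≡ head u xor head v
head-⊻ (_ ∷ _) (_ ∷ _) = refl

tail-⊻ : (u v : Vec Bool (suc N)) → tail (u ⊻ v) ≡ tail u ⊻ tail v
tail-⊻ (_ ∷ _) (_ ∷ _) = refl

head-tail≡false : (u : Vec Bool (suc N)) → head u ≡ false → tail u ≡ replicate N false →
                  u ≡ replicate (suc N) false
head-tail≡false (_ ∷ _) refl refl = refl

-- P is an arbitrary predicate, so it cannot be decided whether P contains a word
-- whose image has leading bit 1: the basis is built in the double-negation monad.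
spanning-list : (P : Code n) → (∀ x y → P x → P y → P (x ⊕ᵥ y)) →
                (h : Word n → Vec Bool N) → (∀ x y → h (x ⊕ᵥ y) ≡ h x ⊻ h y) →
                (∀ {x} → P x → h x ≡ replicate N false → x ≡ zeroWord) →
                ¬ ¬ (∃[ L ] length L ≤ N × P ⊆ Span L)
spanning-list {N = zero} P _ h _ kernel =
  pure ([] , z≤n , λ {x} px → subst (Span []) (sym (kernel px (empty≡[] (h x)))) none)
  where
  open RawMonad ¬¬-Monad
  empty≡[] : (v : Vec Bool 0) → v ≡ []
  empty≡[] [] = refl
spanning-list {n} {suc N} P closed h linear kernel = do
    L , |L|≤N , P₀⊆L ← spanning-list P₀ closed₀ (tail ∘ h) linear₀ kernel₀
    leading? ← ¬¬-excluded-middle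
    pure (extend L |L|≤N P₀⊆L leading?)
  where
  open RawMonad ¬¬-Monad

  lead : Word n → Bool
  lead x = head (h x)

  P₀ : Code n
  P₀ x = P x × lead x ≡ false

  lead-⊕ᵥ : ∀ x y → lead (x ⊕ᵥ y) ≡ lead x xor lead y
  lead-⊕ᵥ x y = trans (cong head (linear x y)) (head-⊻ (h x) (h y))

  closed₀ : ∀ x y → P₀ x → P₀ y → P₀ (x ⊕ᵥ y)
  closed₀ x y (px , x₀) (py , y₀) = closed x y px py , trans (lead-⊕ᵥ x y) (cong₂ _xor_ x₀ y₀)

  linear₀ : ∀ x y → tail (h (x ⊕ᵥ y)) ≡ tail (h x) ⊻ tail (h y)
  linear₀ x y = trans (cong tail (linear x y)) (tail-⊻ (h x) (h y))

  kernel₀ : ∀ {x} → P₀ x → tail (h x) ≡ replicate N false → x ≡ zeroWord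
  kernel₀ {x} (px , x₀) rest = kernel px (head-tail≡false (h x) x₀ rest)

  extend : ∀ L → length L ≤ N → P₀ ⊆ Span L → Dec (∃[ g ] P g × lead g ≡ true) →
           ∃[ L′ ] length L′ ≤ suc N × P ⊆ Span L′
  extend L |L|≤N P₀⊆L (no ∄g) = L , m≤n⇒m≤1+n |L|≤N , λ px → P₀⊆L (px , lead≡false px)
    where
    lead≡false : ∀ {x} → P x → lead x ≡ false
    lead≡false {x} px with lead x in eq
    ... | false = refl
    ... | true = contradiction (x , px , eq) ∄g
  extend L |L|≤N P₀⊆L (yes (g , pg , g₁)) = g ∷ L , s≤s |L|≤N , reduce
    where
    reduce : P ⊆ Span (g ∷ L)
    reduce {x} px with lead x in eq
    ... | false = skip (P₀⊆L (px , eq))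
    ... | true = subst (Span (g ∷ L)) (⊕ᵥ-cancelʳ x g)
      (add (P₀⊆L (closed x g px pg , trans (lead-⊕ᵥ x g) (cong₂ _xor_ eq g₁))))

syndrome : (L : List (Word n)) → Word n → Vec Bool (length L)
syndrome [] w = []
syndrome (g ∷ L) w = inner w g ∷ syndrome L w

syndrome-span : ∀ {L w w′ x} → syndrome L w ≡ syndrome L w′ → Span {n} L x →
                inner w x ≡ inner w′ x
syndrome-span {w = w} {w′} _ none = trans (inner-zeroʳ w) (sym (inner-zeroʳ w′))
syndrome-span eq (skip x∈L) = syndrome-span (∷-injectiveʳ eq) x∈L
syndrome-span {L = g ∷ L} {w} {w′} eq (add {x = x} x∈L) = begin
  inner w (x ⊕ᵥ g)          ≡⟨ inner-distribˡ-⊕ᵥ w x g ⟩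
  inner w x xor inner w g   ≡⟨ cong₂ _xor_ (syndrome-span eq′ x∈L) g-agree ⟩
  inner w′ x xor inner w′ g ≡⟨ inner-distribˡ-⊕ᵥ w′ x g ⟨
  inner w′ (x ⊕ᵥ g)         ∎
  where
  open ≡-Reasoning
  g-agree = proj₁ (∷-injective eq)
  eq′ = proj₂ (∷-injective eq)

syndrome-dual : ∀ {C L w w′} → C ⊆ Span {n} L → syndrome L w ≡ syndrome L w′ →
                Dual C (w ⊕ᵥ w′)
syndrome-dual {w = w} {w′} C⊆L eq y y∈C = begin
  inner (w ⊕ᵥ w′) y          ≡⟨ inner-distribʳ-⊕ᵥ y w w′ ⟩
  inner w y xor inner w′ y   ≡⟨ cong (_xor inner w′ y) (syndrome-span eq (C⊆L y∈C)) ⟩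
  inner w′ y xor inner w′ y  ≡⟨ xor-same (inner w′ y) ⟩
  false                      ∎
  where open ≡-Reasoning

module _ {A : Set} {k : ℕ} (A↔Fin : A ↔ Fin k) where
  open Inverse A↔Fin

  Vec↔Fin^ : ∀ n → Vec A n ↔ Fin (k ^ n)
  Vec↔Fin^ n = mk↔ₛ′ encode (decode n) (encode∘decode n) decode∘encode
    where
    digit : ∀ n → Fin (k ^ suc n) → Fin k × Fin (k ^ n)
    digit n = remQuot {k} (k ^ n)

    encode : ∀ {n} → Vec A n → Fin (k ^ n)
    encode [] = Fin.zero
    encode (x ∷ xs) = combine (to x) (encode xs)

    decode : ∀ n → Fin (k ^ n) → Vec A n
    decode zero _ = []
    decode (suc n) i = from (proj₁ (digit n i)) ∷ decode n (proj₂ (digit n i))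

    encode∘decode : ∀ n i → encode (decode n i) ≡ i
    encode∘decode zero Fin.zero = refl
    encode∘decode (suc n) i = trans
      (cong₂ combine (strictlyInverseˡ (proj₁ (digit n i))) (encode∘decode n (proj₂ (digit n i))))
      (combine-remQuot {k} (k ^ n) i)

    decode∘encode : ∀ {n} (xs : Vec A n) → decode n (encode xs) ≡ xs
    decode∘encode [] = refl
    decode∘encode (x ∷ xs) = cong₂ _∷_
      (trans (cong (from ∘ proj₁) split) (strictlyInverseʳ x))
      (trans (cong (decode _ ∘ proj₂) split) (decode∘encode xs))
      where split = remQuot-combine {k} (to x) (encode xs)

Vec-↣⇒^≤ : {A B : Set} {p q : ℕ} → A ↔ Fin p → B ↔ Fin q → Vec A s ↣ Vec B l → p ^ s ≤ q ^ l
Vec-↣⇒^≤ {s} {l} A↔Fin B↔Fin f = injective⇒≤ (Injection.injective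
  (↣-trans (↔⇒↣ (↔-sym (Vec↔Fin^ A↔Fin s))) (↣-trans f (↔⇒↣ (Vec↔Fin^ B↔Fin l)))))

K↔Fin4 : K ↔ Fin 4
K↔Fin4 = ↔-trans K↔F₂² (Vec↔Fin^ (↔-sym 2↔Bool) 2)

2^<4^ : l ≤ m * 2 → m < s → 2 ^ l < 4 ^ s
2^<4^ {l} {m} {s} l≤2m m<s = begin-strict
  2 ^ l         ≤⟨ ^-monoʳ-≤ 2 l≤2m ⟩
  2 ^ (m * 2)   <⟨ ^-monoʳ-< 2 ≤-refl (*-monoˡ-< 2 m<s) ⟩
  2 ^ (s * 2)   ≡⟨ cong (2 ^_) (*-comm s 2) ⟩
  2 ^ (2 * s)   ≡⟨ ^-*-assoc 2 2 s ⟨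
  4 ^ s         ∎
  where open ≤-Reasoning

Shortened : ∀ s {m} → Code (s + m) → Code s
Shortened s C u = C (u ++ zeroWord)

IsTrivial : Code n → Set
IsTrivial C = ∀ {x} → C x → x ≡ zeroWord

selfDual⇒shortened-nontrivial : m < s → (C : Code (s + m)) → IsLinear C → IsSelfDual C →
                                ¬ IsTrivial (Shortened s C)
selfDual⇒shortened-nontrivial {m} {s} m<s C (_ , closed) selfDual trivial =
  spanning-list C closed (bits ∘ drop s) suffix-linear suffix-kernel λ (L , |L|≤2m , C⊆L) →
    <⇒≱ (2^<4^ |L|≤2m m<s)
        (Vec-↣⇒^≤ K↔Fin4 (↔-sym 2↔Bool) (mk↣ (prefix-syndrome-injective C⊆L)))
  where
  open ≡-Reasoning

  suffix-linear : ∀ x y → bits (drop s (x ⊕ᵥ y)) ≡ bits (drop s x) ⊻ bits (drop s y)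
  suffix-linear x y =
    trans (cong bits (drop-zipWith {m = s} _⊕_ x y)) (bits-⊕ᵥ (drop s x) (drop s y))

  suffix-kernel : ∀ {x} → C x → bits (drop s x) ≡ replicate (m * 2) false → x ≡ zeroWord
  suffix-kernel {x} x∈C suffix≡0 = begin
    x                           ≡⟨ x≡prefix ⟩
    take s x ++ zeroWord        ≡⟨ cong (_++ zeroWord) (trivial (subst C x≡prefix x∈C)) ⟩
    zeroWord {s} ++ zeroWord    ≡⟨ zeroWord-++ s ⟩
    zeroWord                    ∎
    where
    x≡prefix : x ≡ take s x ++ zeroWord
    x≡prefix = trans (sym (take++drop≡id s x))
                     (cong (take s x ++_) (bits≡0⇒zeroWord (drop s x) suffix≡0))

  prefix-syndrome-injective : ∀ {L} → C ⊆ Span L → ∀ {u u′} →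
    syndrome L (u ++ zeroWord) ≡ syndrome L (u′ ++ zeroWord) → u ≡ u′
  prefix-syndrome-injective C⊆L {u} {u′} eq =
    ⊕ᵥ≡zeroWord⇒≡ u u′ (trivial (subst C sum≡ (proj₂ (selfDual _) (syndrome-dual C⊆L eq))))
    where
    sum≡ : (u ++ zeroWord) ⊕ᵥ (u′ ++ zeroWord) ≡ (u ⊕ᵥ u′) ++ zeroWord {m}
    sum≡ = trans (zipWith-++ _⊕_ u zeroWord u′ zeroWord)
                 (cong ((u ⊕ᵥ u′) ++_) (⊕ᵥ-identityˡ zeroWord))

lightCodeword≡zeroWord : ∀ {C : Code n} {d y} → (∀ x → C x → ¬ x ≡ zeroWord → d ≤ wt x) →
                         C y → wt y < d → y ≡ zeroWord
lightCodeword≡zeroWord {y = y} minimal y∈C light with zeroWord? y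
... | yes y≡0 = y≡0
... | no y≢0 = contradiction (minimal y y∈C y≢0) (<⇒≱ light)

selfDual⇒minimalWeight≤ : ∀ {d} → s + m ≡ n → m < s → (C : Code n) → IsLinear C → IsSelfDual C →
                          (∀ x → C x → ¬ x ≡ zeroWord → d ≤ wt x) → d ≤ s
selfDual⇒minimalWeight≤ {s} {m} {d = d} refl m<s C linear selfDual minimal with d ≤? s
... | yes d≤s = d≤s
... | no d≰s = ⊥-elim (selfDual⇒shortened-nontrivial m<s C linear selfDual shortened-trivial)
  where
  shortened-trivial : IsTrivial (Shortened s C)
  shortened-trivial {u} u∈C = ++-injectiveˡ u zeroWord
    (trans (lightCodeword≡zeroWord minimal u∈C light) (sym (zeroWord-++ s)))
    where
    light : wt (u ++ zeroWord {m}) < d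
    light = begin-strict
      wt (u ++ zeroWord {m})          ≡⟨ wt-++ u zeroWord ⟩
      wt u + wt (zeroWord {m})        ≡⟨ cong (wt u +_) (wt-zeroWord {m}) ⟩
      wt u + 0                        ≡⟨ +-identityʳ (wt u) ⟩
      wt u                            ≤⟨ wt≤length u ⟩
      s                               <⟨ ≰⇒> d≰s ⟩
      d                               ∎
      where open ≤-Reasoning

half-split : ∀ n .{{_ : NonZero n}} → ∃[ m ] m < n / 2 + 1 × n / 2 + 1 + m ≡ n
half-split n with n / 2 | n % 2 | m%n<n n 2 | m≡m%n+[m/n]*n n 2
... | zero  | 0 | _ | n≡0 = contradiction n≡0 (≢-nonZero⁻¹ n)
... | suc q | 0 | _ | n≡2q+2 = q , s≤s (m≤m+n q 1) , trans (identity q) (sym n≡2q+2)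
  where
  identity : ∀ q → suc q + 1 + q ≡ 0 + suc q * 2
  identity = solve-∀
... | q     | 1 | _ | n≡2q+1 = q , m<m+n q (s≤s z≤n) , trans (identity q) (sym n≡2q+1)
  where
  identity : ∀ q → q + 1 + q ≡ 1 + q * 2
  identity = solve-∀
... | _     | suc (suc _) | s≤s (s≤s ()) | _

theorem11 : (n : ℕ) (C : Code n) (d : ℕ) → IsLinear C → IsSelfDual C →
    IsMinimalWeight C d → d ≤ n / 2 + 1
theorem11 zero C d _ _ (([] , _ , []≢0 , _) , _) = contradiction refl []≢0
theorem11 n@(suc _) C d linear selfDual (_ , minimal) =
  let m , m<s , s+m≡n = half-split n in
  selfDual⇒minimalWeight≤ s+m≡n m<s C linear selfDual minimal
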